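{- If $G$ is a connected graph with $\mathrm{rank}_d(G)=3$, then $G$ is isomorphic to one of $K_3$, $P_3$, or $C_4$.
   Context: All graphs are finite and simple. For a connected graph $G$ with vertices $v_1,\dots,v_n$, $D(G)$ is the $n\times n$ matrix with $(i,j)$-entry the distance $d_G(v_i,v_j)$ (length of a shortest path), and $\mathrm{rank}_d(G)$ is the rank of $D(G)$. $K_3$ is the complete graph on 3 vertices, $P_3$ the path on 3 vertices, $C_4$ the cycle on 4 vertices. -}

module Defs where

open import Data.Nat using (ℕ; zero; suc; _<_)
open import Data.Fin using (Fin; zero; suc)
open import Data.Bool using (Bool; true; false)
open import Data.Integer using (+_)
open import Data.Rational using (ℚ; 0ℚ; _+_; _*_; _/_)
open import Data.Product using (Σ; ∃; _×_; _,_)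
open import Data.Sum using (_⊎_)
open import Relation.Nullary using (¬_)
open import Relation.Binary.PropositionalEquality using (_≡_)
open import Function.Bundles using (_↔_; Inverse)

record Graph (n : ℕ) : Set where
  field
    adj   : Fin n → Fin n → Bool
    sym   : ∀ u v → adj u v ≡ adj v u
    irref : ∀ u → adj u u ≡ false
open Graph public

data Walk {n : ℕ} (G : Graph n) : ℕ → Fin n → Fin n → Set where
  here : ∀ {u} → Walk G zero u u
  step : ∀ {k u w v} → adj G u w ≡ true → Walk G k w v → Walk G (suc k) u v

Connected : ∀ {n} → Graph n → Set
Connected {n} G = ∀ (u v : Fin n) → ∃ λ k → Walk G k u v

IsDist : ∀ {n} → Graph n → Fin n → Fin n → ℕ → Set
IsDist G u v d = Walk G d u v × (∀ k → k < d → ¬ Walk G k u v)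

IsDistMatrix : ∀ {n} → Graph n → (Fin n → Fin n → ℕ) → Set
IsDistMatrix {n} G D = ∀ (i j : Fin n) → IsDist G i j (D i j)

sumℚ : ∀ {n} → (Fin n → ℚ) → ℚ
sumℚ {zero}  f = 0ℚ
sumℚ {suc n} f = f zero + sumℚ (λ i → f (suc i))

ℕtoℚ : ℕ → ℚ
ℕtoℚ k = (+ k) / 1

RowsIndependent : ∀ {n m r} → (Fin n → Fin m → ℚ) → (Fin r → Fin n) → Set
RowsIndependent {m = m} {r = r} M f =
  ∀ (c : Fin r → ℚ) →
    (∀ (j : Fin m) → sumℚ (λ i → c i * M (f i) j) ≡ 0ℚ) →
    ∀ (i : Fin r) → c i ≡ 0ℚ

HasRank : ∀ {n m} → (Fin n → Fin m → ℚ) → ℕ → Set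
HasRank {n} M r =
  (Σ (Fin r → Fin n) λ f → RowsIndependent M f) ×
  (∀ (g : Fin (suc r) → Fin n) → ¬ RowsIndependent M g)

HasDistanceRank : ∀ {n} → Graph n → ℕ → Set
HasDistanceRank {n} G r =
  Σ (Fin n → Fin n → ℕ) λ D → IsDistMatrix G D × HasRank (λ i j → ℕtoℚ (D i j)) r

Iso : ∀ {n m} → Graph n → Graph m → Set
Iso {n} {m} G H =
  Σ (Fin n ↔ Fin m) λ σ → ∀ u v → adj H (Inverse.to σ u) (Inverse.to σ v) ≡ adj G u v

K3adj : Fin 3 → Fin 3 → Bool
K3adj zero zero = false
K3adj (suc zero) (suc zero) = false
K3adj (suc (suc zero)) (suc (suc zero)) = false
K3adj _ _ = true

K3 : Graph 3
K3 = record { adj = K3adj ; sym = s ; irref = ir }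
  where
  s : ∀ u v → K3adj u v ≡ K3adj v u
  s zero zero = Relation.Binary.PropositionalEquality.refl
  s zero (suc zero) = Relation.Binary.PropositionalEquality.refl
  s zero (suc (suc zero)) = Relation.Binary.PropositionalEquality.refl
  s (suc zero) zero = Relation.Binary.PropositionalEquality.refl
  s (suc zero) (suc zero) = Relation.Binary.PropositionalEquality.refl
  s (suc zero) (suc (suc zero)) = Relation.Binary.PropositionalEquality.refl
  s (suc (suc zero)) zero = Relation.Binary.PropositionalEquality.refl
  s (suc (suc zero)) (suc zero) = Relation.Binary.PropositionalEquality.refl
  s (suc (suc zero)) (suc (suc zero)) = Relation.Binary.PropositionalEquality.refl
  ir : ∀ u → K3adj u u ≡ false
  ir zero = Relation.Binary.PropositionalEquality.refl
  ir (suc zero) = Relation.Binary.PropositionalEquality.refl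
  ir (suc (suc zero)) = Relation.Binary.PropositionalEquality.refl

P3adj : Fin 3 → Fin 3 → Bool
P3adj zero (suc zero) = true
P3adj (suc zero) zero = true
P3adj (suc zero) (suc (suc zero)) = true
P3adj (suc (suc zero)) (suc zero) = true
P3adj _ _ = false

C4adj : Fin 4 → Fin 4 → Bool
C4adj zero (suc zero) = true
C4adj (suc zero) zero = true
C4adj (suc zero) (suc (suc zero)) = true
C4adj (suc (suc zero)) (suc zero) = true
C4adj (suc (suc zero)) (suc (suc (suc zero))) = true
C4adj (suc (suc (suc zero))) (suc (suc zero)) = true
C4adj (suc (suc (suc zero))) zero = true
C4adj zero (suc (suc (suc zero))) = true
C4adj _ _ = false

open import Data.Fin.Properties using (all?)
open import Relation.Nullary.Decidable using (True; toWitness)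
open import Data.Bool.Properties using () renaming (_≟_ to _≟B_)

P3 : Graph 3
P3 = record
  { adj = P3adj
  ; sym = λ u v → toWitness {a? = all? λ u → all? λ v → P3adj u v ≟B P3adj v u} _ u v
  ; irref = toWitness {a? = all? λ u → P3adj u u ≟B false} _ }

C4 : Graph 4
C4 = record
  { adj = C4adj
  ; sym = λ u v → toWitness {a? = all? λ u → all? λ v → C4adj u v ≟B C4adj v u} _ u v
  ; irref = toWitness {a? = all? λ u → C4adj u u ≟B false} _ }

{-# OPTIONS --safe #-}

-- Rank three forbids four independent rows of D(G). A shortest path of length three would carry
-- the nonsingular distance matrix of P4, so G has diameter at most two; then the distance matrix on
-- any four vertices is read off the induced subgraph, and among the 64 graphs on four labelled
-- vertices only the 4-cycles give a singular one. Five vertices would need a 4-cycle on every four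
-- of them, which is impossible, and three independent rows need three vertices. So G has four
-- vertices and is C4, or three and, being connected, is K3 or P3.

module Submission where

open import Defs hiding (sym)
open import Data.Nat using (ℕ; zero; suc; _≤_; z≤n; s≤s; ∣_-_∣) renaming (_+_ to _+ℕ_)
open import Data.Nat.Properties
  using (≤-antisym; ≮⇒≥; +-monoʳ-<; +-monoˡ-<; ∣-∣-identityʳ) renaming (+-identityʳ to +ℕ-identityʳ)
open import Data.Fin using (Fin; zero; suc; toℕ; punchIn; inject≤; _ℕ-ℕ_) renaming (_≟_ to _≟ᶠ_)
open import Data.Fin.Patterns using (0F; 1F; 2F; 3F; 4F)
open import Data.Fin.Properties
  using (all?; pigeonhole; <⇒≢; punchIn-injective; toℕ-inject≤; inject≤-injective)
open import Data.Fin.Permutation using (Permutation′; _⟨$⟩ʳ_; id; transpose)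
open import Data.Bool using (Bool; true; false; if_then_else_)
open import Data.Bool.Properties using () renaming (_≟_ to _≟ᵇ_)
open import Data.Rational using (ℚ; 0ℚ; 1ℚ; _+_; _*_; -_; _-_; 1/_; NonZero; ≢-nonZero)
open import Data.Rational.Properties
  using ( _≟_; +-*-commutativeRing; *-comm; *-assoc; *-zeroˡ; *-identityˡ; *-identityʳ
        ; +-identityˡ; +-identityʳ; +-inverseʳ; *-inverseʳ; *-distribʳ-+; neg-distribˡ-*; neg-distribʳ-* )
open import Algebra.Bundles using (CommutativeRing)
open import Algebra.Properties.Semiring.Sum (CommutativeRing.semiring +-*-commutativeRing)
  using (sum; ∑-comm; ∑-distrib-+; *-distribʳ-sum; sum-replicate-zero; sum-cong-≗)
open import Data.Product using (Σ; _×_; _,_; proj₁; proj₂)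
open import Data.Product.Properties using (≡-dec)
open import Data.Sum using (_⊎_; inj₁; inj₂; map₂; fromInj₁)
open import Data.Empty using (⊥; ⊥-elim)
open import Function.Base using (_∘_)
open import Function.Bundles using (mk⇔)
open import Function.Definitions using (Injective)
open import Relation.Nullary using (Dec; yes; no; does; ¬_; contradiction)
open import Relation.Nullary.Decidable using (True; toWitness; map′; does-⇔; _×-dec_; _⊎-dec_; ¬?)
open import Relation.Binary.PropositionalEquality

-- Linear algebra over ℚ

sumℚ≡sum : ∀ {n} (x : Fin n → ℚ) → sumℚ x ≡ sum x
sumℚ≡sum {zero}  x = refl
sumℚ≡sum {suc n} x = cong (x zero +_) (sumℚ≡sum (x ∘ suc))

sum-zero : ∀ {n} (x : Fin n → ℚ) → (∀ i → x i ≡ 0ℚ) → sum x ≡ 0ℚ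
sum-zero {n} x x≗0 = trans (sum-cong-≗ x≗0) (sum-replicate-zero n)

δ : ∀ {n} → Fin n → Fin n → ℚ
δ zero    zero    = 1ℚ
δ zero    (suc _) = 0ℚ
δ (suc _) zero    = 0ℚ
δ (suc i) (suc j) = δ i j

δ-refl : ∀ {n} (i : Fin n) → δ i i ≡ 1ℚ
δ-refl zero    = refl
δ-refl (suc i) = δ-refl i

δ-≢ : ∀ {n} {i j : Fin n} → i ≢ j → δ i j ≡ 0ℚ
δ-≢ {i = zero}  {zero}  i≢j = contradiction refl i≢j
δ-≢ {i = zero}  {suc j} _   = refl
δ-≢ {i = suc i} {zero}  _   = refl
δ-≢ {i = suc i} {suc j} i≢j = δ-≢ (i≢j ∘ cong suc)

sum-δ : ∀ {n} (x : Fin n → ℚ) k → sum (λ i → δ i k * x i) ≡ x k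
sum-δ x zero = begin
  1ℚ * x zero + sum (λ i → 0ℚ * x (suc i))
    ≡⟨ cong₂ _+_ (*-identityˡ (x zero)) (sum-zero _ (*-zeroˡ ∘ x ∘ suc)) ⟩
  x zero + 0ℚ
    ≡⟨ +-identityʳ (x zero) ⟩
  x zero ∎
  where open ≡-Reasoning
sum-δ x (suc k) = begin
  0ℚ * x zero + sum (λ i → δ i k * x (suc i))
    ≡⟨ cong₂ _+_ (*-zeroˡ (x zero)) (sum-δ (x ∘ suc) k) ⟩
  0ℚ + x (suc k)
    ≡⟨ +-identityˡ (x (suc k)) ⟩
  x (suc k) ∎
  where open ≡-Reasoning

x*y≡0⇒x≡0 : ∀ x y → y ≢ 0ℚ → x * y ≡ 0ℚ → x ≡ 0ℚ
x*y≡0⇒x≡0 x y y≢0 xy≡0 = begin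
  x                ≡⟨ *-identityʳ x ⟨
  x * 1ℚ           ≡⟨ cong (x *_) (*-inverseʳ y) ⟨
  x * (y * y⁻¹)    ≡⟨ *-assoc x y y⁻¹ ⟨
  x * y * y⁻¹      ≡⟨ cong (_* y⁻¹) xy≡0 ⟩
  0ℚ * y⁻¹         ≡⟨ *-zeroˡ y⁻¹ ⟩
  0ℚ               ∎
  where
  open ≡-Reasoning
  instance
    y-nonZero : NonZero y
    y-nonZero = ≢-nonZero y≢0
  y⁻¹ : ℚ
  y⁻¹ = 1/ y

Matrix : ℕ → Set
Matrix n = Fin n → Fin n → ℚ

IsScaledInverse : ∀ {n} → Matrix n → Matrix n → ℚ → Set
IsScaledInverse A B d = ∀ i k → sum (λ j → A i j * B j k) ≡ δ i k * d

-- If c A = 0 then c d = c (A B) = (c A) B = 0.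
scaled-inverse⇒rows-independent :
  ∀ {n m r} (M : Fin n → Fin m → ℚ) (f : Fin r → Fin n) (g : Fin r → Fin m) {A B : Matrix r} {d : ℚ} →
  (∀ i j → M (f i) (g j) ≡ A i j) → IsScaledInverse A B d → d ≢ 0ℚ → RowsIndependent M f
scaled-inverse⇒rows-independent M f g {A} {B} {d} M≡A AB≡dI d≢0 c cM≡0 k =
  x*y≡0⇒x≡0 (c k) d d≢0 (begin
    c k * d
      ≡⟨ sum-δ (λ i → c i * d) k ⟨
    sum (λ i → δ i k * (c i * d))
      ≡⟨ sum-cong-≗ (λ i → rearrange (δ i k) (c i)) ⟩
    sum (λ i → δ i k * d * c i)
      ≡⟨ sum-cong-≗ (λ i → cong (_* c i) (AB≡dI i k)) ⟨
    sum (λ i → sum (λ j → A i j * B j k) * c i)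
      ≡⟨ sum-cong-≗ (λ i → *-distribʳ-sum (c i) (λ j → A i j * B j k)) ⟩
    sum (λ i → sum (λ j → A i j * B j k * c i))
      ≡⟨ sum-cong-≗ (λ i → sum-cong-≗ λ j → reassoc (A i j) (B j k) (c i)) ⟩
    sum (λ i → sum (λ j → c i * A i j * B j k))
      ≡⟨ ∑-comm (λ i j → c i * A i j * B j k) ⟩
    sum (λ j → sum (λ i → c i * A i j * B j k))
      ≡⟨ sum-cong-≗ (λ j → *-distribʳ-sum (B j k) (λ i → c i * A i j)) ⟨
    sum (λ j → sum (λ i → c i * A i j) * B j k)
      ≡⟨ sum-zero _ (λ j → trans (cong (_* B j k) (column j)) (*-zeroˡ (B j k))) ⟩
    0ℚ ∎)
  where
  open ≡-Reasoning
  column : ∀ j → sum (λ i → c i * A i j) ≡ 0ℚ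
  column j = begin
    sum (λ i → c i * A i j)          ≡⟨ sum-cong-≗ (λ i → cong (c i *_) (M≡A i j)) ⟨
    sum (λ i → c i * M (f i) (g j))  ≡⟨ sumℚ≡sum (λ i → c i * M (f i) (g j)) ⟨
    sumℚ (λ i → c i * M (f i) (g j)) ≡⟨ cM≡0 (g j) ⟩
    0ℚ                               ∎
  rearrange : ∀ a x → a * (x * d) ≡ a * d * x
  rearrange a x = trans (cong (a *_) (*-comm x d)) (sym (*-assoc a d x))
  reassoc : ∀ a b x → a * b * x ≡ x * a * b
  reassoc a b x = trans (*-comm (a * b) x) (sym (*-assoc x a b))

rows-independent⇒injective : ∀ {n m r} (M : Fin n → Fin m → ℚ) (f : Fin r → Fin n) →
                             RowsIndependent M f → Injective _≡_ _≡_ f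
rows-independent⇒injective M f independent {i} {j} fi≡fj with i ≟ᶠ j
... | yes i≡j = i≡j
... | no  i≢j = contradiction c-i≡0 c-i≢0
  where
  open ≡-Reasoning
  c : Fin _ → ℚ
  c l = δ l i - δ l j
  combination≡0 : ∀ col → sumℚ (λ l → c l * M (f l) col) ≡ 0ℚ
  combination≡0 col = begin
    sumℚ (λ l → c l * x l)
      ≡⟨ sumℚ≡sum (λ l → c l * x l) ⟩
    sum (λ l → c l * x l)
      ≡⟨ sum-cong-≗ (λ l → split (δ l i) (δ l j) (x l)) ⟩
    sum (λ l → δ l i * x l + δ l j * - x l)
      ≡⟨ ∑-distrib-+ (λ l → δ l i * x l) (λ l → δ l j * - x l) ⟩
    sum (λ l → δ l i * x l) + sum (λ l → δ l j * - x l)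
      ≡⟨ cong₂ _+_ (sum-δ x i) (sum-δ (-_ ∘ x) j) ⟩
    x i - x j
      ≡⟨ cong (λ y → x i - M y col) fi≡fj ⟨
    x i - x i
      ≡⟨ +-inverseʳ (x i) ⟩
    0ℚ ∎
    where
    x : Fin _ → ℚ
    x l = M (f l) col
    split : ∀ a b y → (a - b) * y ≡ a * y + b * - y
    split a b y = trans (*-distribʳ-+ y a (- b))
                        (cong (a * y +_) (trans (sym (neg-distribˡ-* b y)) (neg-distribʳ-* b y)))
  c-i≡0 : c i ≡ 0ℚ
  c-i≡0 = independent c combination≡0 i
  c-i≢0 : c i ≢ 0ℚ
  c-i≢0 c-i≡0′ with trans (sym c-i≡0′) (cong₂ _-_ (δ-refl i) (δ-≢ i≢j))
  ... | ()

rows-independent⇒≤ : ∀ {n m r} (M : Fin n → Fin m → ℚ) (f : Fin r → Fin n) →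
                     RowsIndependent M f → r ≤ n
rows-independent⇒≤ M f independent = ≮⇒≥ λ n<r →
  let (i , j , i<j , fi≡fj) = pigeonhole n<r f
  in <⇒≢ i<j (rows-independent⇒injective M f independent fi≡fj)

minor : ∀ {n} → Fin (suc n) → Fin (suc n) → Matrix (suc n) → Matrix n
minor i j A a b = A (punchIn i a) (punchIn j b)

sign : ℕ → ℚ
sign zero    = 1ℚ
sign (suc k) = - sign k

det : ∀ {n} → Matrix n → ℚ
det {zero}  A = 1ℚ
det {suc n} A = sum (λ j → sign (toℕ j) * (A zero j * det (minor zero j A)))

adjugate : ∀ {n} → Matrix (suc n) → Matrix (suc n)
adjugate A j k = sign (toℕ j +ℕ toℕ k) * det (minor k j A)

-- The adjugate identity holds for every matrix, but here it is part of the definition: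
-- it is only ever established by evaluation, for concrete matrices.
Nonsingular : ∀ {n} → Matrix (suc n) → Set
Nonsingular A = IsScaledInverse A (adjugate A) (det A) × det A ≢ 0ℚ

nonsingular? : ∀ {n} (A : Matrix (suc n)) → Dec (Nonsingular A)
nonsingular? A =
  (all? λ i → all? λ k → sum (λ j → A i j * adjugate A j k) ≟ δ i k * det A) ×-dec ¬? (det A ≟ 0ℚ)

nonsingular-submatrix⇒rows-independent :
  ∀ {n m r} (M : Fin n → Fin m → ℚ) (f : Fin (suc r) → Fin n) (g : Fin (suc r) → Fin m) {A : Matrix (suc r)} →
  (∀ i j → M (f i) (g j) ≡ A i j) → Nonsingular A → RowsIndependent M f
nonsingular-submatrix⇒rows-independent M f g {A} M≡A (AB≡dI , d≢0) =
  scaled-inverse⇒rows-independent M f g {B = adjugate A} M≡A AB≡dI d≢0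

pathDistanceMatrix : ∀ n → Matrix n
pathDistanceMatrix n i j = ℕtoℚ ∣ toℕ i - toℕ j ∣

P4-nonsingular : Nonsingular (pathDistanceMatrix 4)
P4-nonsingular = toWitness {a? = nonsingular? (pathDistanceMatrix 4)} _

-- Walks and distances

module _ {n : ℕ} (G : Graph n) where

  _++ʷ_ : ∀ {a b u v w} → Walk G a u v → Walk G b v w → Walk G (a +ℕ b) u w
  here     ++ʷ q = q
  step e p ++ʷ q = step e (p ++ʷ q)

  snoc : ∀ {k u v w} → Walk G k u v → adj G v w ≡ true → Walk G (suc k) u w
  snoc here       e = step e here
  snoc (step e p) f = step e (snoc p f)

  reverse : ∀ {k u v} → Walk G k u v → Walk G k v u
  reverse here = here
  reverse {u = u} (step {w = w} e p) = snoc (reverse p) (trans (Graph.sym G w u) e)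

  adj⇒≢ : ∀ {u v} → adj G u v ≡ true → u ≢ v
  adj⇒≢ {u} e refl with trans (sym e) (irref G u)
  ... | ()

  length0⇒≡ : ∀ {u v} → Walk G 0 u v → u ≡ v
  length0⇒≡ here = refl

  length1⇒adj : ∀ {u v} → Walk G 1 u v → adj G u v ≡ true
  length1⇒adj (step e here) = e

  isolated⇒disconnected : ∀ {u v} → (∀ w → adj G u w ≡ false) → u ≢ v → ¬ Connected G
  isolated⇒disconnected {u} {v} isolated u≢v connected = no-walk (proj₂ (connected u v))
    where
    no-walk : ∀ {k} → ¬ Walk G k u v
    no-walk here = u≢v refl
    no-walk (step {w = w} e _) with trans (sym e) (isolated w)
    ... | ()

  IsDist-unique : ∀ {u v d d′} → IsDist G u v d → IsDist G u v d′ → d ≡ d′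
  IsDist-unique (p , p-shortest) (q , q-shortest) =
    ≤-antisym (≮⇒≥ λ d′<d → p-shortest _ d′<d q) (≮⇒≥ λ d<d′ → q-shortest _ d<d′ p)

  IsDist-sym : ∀ {u v d} → IsDist G u v d → IsDist G v u d
  IsDist-sym (p , shortest) = reverse p , λ k k<d q → shortest k k<d (reverse q)

  IsDist-refl : ∀ u → IsDist G u u 0
  IsDist-refl u = here , λ _ ()

  IsDist-adj : ∀ {u v} → adj G u v ≡ true → IsDist G u v 1
  IsDist-adj e = step e here , λ { zero (s≤s z≤n) p → adj⇒≢ e (length0⇒≡ p) }

  IsDist-infix : ∀ {u v x y a l c} → IsDist G u v (a +ℕ (l +ℕ c)) →
                 Walk G a u x → Walk G l x y → Walk G c y v → IsDist G x y l
  IsDist-infix {a = a} {c = c} (_ , shortest) p q r =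
    q , λ k k<l q′ → shortest (a +ℕ (k +ℕ c)) (+-monoʳ-< a (+-monoˡ-< c k<l)) (p ++ʷ (q′ ++ʷ r))

  vertex : ∀ {k u v} → Walk G k u v → Fin (suc k) → Fin n
  vertex {u = u} p          zero    = u
  vertex         (step e p) (suc i) = vertex p i

  prefix : ∀ {k u v} (p : Walk G k u v) (i : Fin (suc k)) → Walk G (toℕ i) u (vertex p i)
  prefix p          zero    = here
  prefix (step e p) (suc i) = step e (prefix p i)

  suffix : ∀ {k u v} (p : Walk G k u v) (i : Fin (suc k)) → Walk G (k ℕ-ℕ i) (vertex p i) v
  suffix p          zero    = p
  suffix (step e p) (suc i) = suffix p i

  toℕ+ℕ-ℕ : ∀ k (i : Fin (suc k)) → toℕ i +ℕ (k ℕ-ℕ i) ≡ k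
  toℕ+ℕ-ℕ k       zero    = refl
  toℕ+ℕ-ℕ (suc k) (suc i) = cong suc (toℕ+ℕ-ℕ k i)

  IsDist-from-start : ∀ {k u v} (d : IsDist G u v k) i → IsDist G u (vertex (proj₁ d) i) (toℕ i)
  IsDist-from-start {k} d@(p , _) i =
    IsDist-infix (subst (IsDist G _ _) (sym (toℕ+ℕ-ℕ k i)) d) here (prefix p i) (suffix p i)

  IsDist-along : ∀ {k u v} (d : IsDist G u v k) i j →
                 IsDist G (vertex (proj₁ d) i) (vertex (proj₁ d) j) ∣ toℕ i - toℕ j ∣
  IsDist-along d zero    j    = IsDist-from-start d j
  IsDist-along d (suc i) zero =
    subst (IsDist G _ _) (sym (∣-∣-identityʳ (suc (toℕ i)))) (IsDist-sym (IsDist-from-start d (suc i)))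
  IsDist-along d@(step e p , _) (suc i) (suc j) = IsDist-along rest i j
    where
    rest : IsDist G (vertex p zero) _ _
    rest = IsDist-infix (subst (IsDist G _ _) (cong suc (sym (+ℕ-identityʳ _))) d) (step e here) p here

-- Distance matrices

diam2Distance : ∀ {r} → (Fin r → Fin r → Bool) → Fin r → Fin r → ℕ
diam2Distance a i j = if does (i ≟ᶠ j) then 0 else if a i j then 1 else 2

diam2Distance-cong : ∀ {r} {a b : Fin r → Fin r → Bool} i j → a i j ≡ b i j →
                     diam2Distance a i j ≡ diam2Distance b i j
diam2Distance-cong i j = cong (λ x → if does (i ≟ᶠ j) then 0 else if x then 1 else 2)

diam2Distance-injective : ∀ {r s} (a : Fin s → Fin s → Bool) {f : Fin r → Fin s} → Injective _≡_ _≡_ f →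
                          ∀ i j → diam2Distance a (f i) (f j) ≡ diam2Distance (λ x y → a (f x) (f y)) i j
diam2Distance-injective a {f} f-injective i j =
  cong (λ x → if x then 0 else if a (f i) (f j) then 1 else 2)
       (does-⇔ (mk⇔ f-injective (cong f)) (f i ≟ᶠ f j) (i ≟ᶠ j))

module Distances {n : ℕ} {G : Graph n} {D : Fin n → Fin n → ℕ} (isD : IsDistMatrix G D) where

  D-unique : ∀ {u v d} → IsDist G u v d → D u v ≡ d
  D-unique = IsDist-unique G (isD _ _)

  D≡0⇒≡ : ∀ {u v} → D u v ≡ 0 → u ≡ v
  D≡0⇒≡ {u} {v} d≡0 = length0⇒≡ G (subst (λ k → Walk G k u v) d≡0 (proj₁ (isD u v)))

  D≡1⇒adj : ∀ {u v} → D u v ≡ 1 → adj G u v ≡ true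
  D≡1⇒adj {u} {v} d≡1 = length1⇒adj G (subst (λ k → Walk G k u v) d≡1 (proj₁ (isD u v)))

  path-submatrix : ∀ {u v} m → m ≤ D u v →
                   Σ (Fin (suc m) → Fin n) λ f → ∀ i j → D (f i) (f j) ≡ ∣ toℕ i - toℕ j ∣
  path-submatrix {u} {v} m m≤d = along ∘ position , λ i j →
    D-unique (subst (IsDist G _ _) (cong₂ ∣_-_∣ (toℕ-inject≤ i _) (toℕ-inject≤ j _))
                    (IsDist-along G (isD u v) (position i) (position j)))
    where
    position : Fin (suc m) → Fin (suc (D u v))
    position i = inject≤ i (s≤s m≤d)
    along : Fin (suc (D u v)) → Fin n
    along = vertex G (proj₁ (isD u v))

  D≡diam2Distance : (∀ u v → D u v ≤ 2) → ∀ u v → D u v ≡ diam2Distance (adj G) u v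
  D≡diam2Distance diameter≤2 u v with u ≟ᶠ v | adj G u v in uv
  ... | yes refl | _     = D-unique (IsDist-refl G u)
  ... | no _     | true  = D-unique (IsDist-adj G uv)
  ... | no u≢v   | false = non-adjacent (D u v) refl (diameter≤2 u v)
    where
    non-adjacent : ∀ d → D u v ≡ d → d ≤ 2 → d ≡ 2
    non-adjacent 0                 d≡0 _ = contradiction (D≡0⇒≡ d≡0) u≢v
    non-adjacent 1                 d≡1 _ = contradiction (trans (sym (D≡1⇒adj d≡1)) uv) λ ()
    non-adjacent 2                 _   _ = refl
    non-adjacent (suc (suc (suc _))) _ (s≤s (s≤s ()))

-- Four-vertex graphs

edges4 : Bool → Bool → Bool → Bool → Bool → Bool → Fin 4 → Fin 4 → Bool
edges4 a b c d e f 0F 0F = false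
edges4 a b c d e f 0F 1F = a
edges4 a b c d e f 0F 2F = b
edges4 a b c d e f 0F 3F = c
edges4 a b c d e f 1F 0F = a
edges4 a b c d e f 1F 1F = false
edges4 a b c d e f 1F 2F = d
edges4 a b c d e f 1F 3F = e
edges4 a b c d e f 2F 0F = b
edges4 a b c d e f 2F 1F = d
edges4 a b c d e f 2F 2F = false
edges4 a b c d e f 2F 3F = f
edges4 a b c d e f 3F 0F = c
edges4 a b c d e f 3F 1F = e
edges4 a b c d e f 3F 2F = f
edges4 a b c d e f 3F 3F = false

adj≡edges4 : (H : Graph 4) → ∀ u v →
             adj H u v ≡ edges4 (adj H 0F 1F) (adj H 0F 2F) (adj H 0F 3F) (adj H 1F 2F) (adj H 1F 3F) (adj H 2F 3F) u v
adj≡edges4 H 0F 0F = irref H 0F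
adj≡edges4 H 0F 1F = refl
adj≡edges4 H 0F 2F = refl
adj≡edges4 H 0F 3F = refl
adj≡edges4 H 1F 0F = Graph.sym H 1F 0F
adj≡edges4 H 1F 1F = irref H 1F
adj≡edges4 H 1F 2F = refl
adj≡edges4 H 1F 3F = refl
adj≡edges4 H 2F 0F = Graph.sym H 2F 0F
adj≡edges4 H 2F 1F = Graph.sym H 2F 1F
adj≡edges4 H 2F 2F = irref H 2F
adj≡edges4 H 2F 3F = refl
adj≡edges4 H 3F 0F = Graph.sym H 3F 0F
adj≡edges4 H 3F 1F = Graph.sym H 3F 1F
adj≡edges4 H 3F 2F = Graph.sym H 3F 2F
adj≡edges4 H 3F 3F = irref H 3F

-- Indexed by the adjacencies of 01, 02, 03, 12, 13, 23 as in edges4; cycle-ijkl is the cycle i-j-k-l-i.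
data C4Edges : Bool → Bool → Bool → Bool → Bool → Bool → Set where
  cycle-0123 : C4Edges true  false true  true  false true
  cycle-0213 : C4Edges false true  true  true  true  false
  cycle-0132 : C4Edges true  true  false false true  true

_≟⁶_ : (x y : Bool × Bool × Bool × Bool × Bool × Bool) → Dec (x ≡ y)
_≟⁶_ = ≡-dec _≟ᵇ_ (≡-dec _≟ᵇ_ (≡-dec _≟ᵇ_ (≡-dec _≟ᵇ_ (≡-dec _≟ᵇ_ _≟ᵇ_))))

C4Edges? : ∀ a b c d e f → Dec (C4Edges a b c d e f)
C4Edges? a b c d e f with (a , b , c , d , e , f) ≟⁶ (true , false , true , true , false , true)
                        | (a , b , c , d , e , f) ≟⁶ (false , true , true , true , true , false)
                        | (a , b , c , d , e , f) ≟⁶ (true , true , false , false , true , true)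
... | yes refl | _        | _        = yes cycle-0123
... | no _     | yes refl | _        = yes cycle-0213
... | no _     | no _     | yes refl = yes cycle-0132
... | no ¬0123 | no ¬0213 | no ¬0132 =
  no λ { cycle-0123 → ¬0123 refl ; cycle-0213 → ¬0213 refl ; cycle-0132 → ¬0132 refl }

∀-Bool? : {P : Bool → Set} → (∀ b → Dec (P b)) → Dec (∀ b → P b)
∀-Bool? P? = map′ (λ { (t , f) true → t ; (t , f) false → f }) (λ h → h true , h false)
                  (P? true ×-dec P? false)

diam2Matrix : ∀ {r} → (Fin r → Fin r → Bool) → Matrix r
diam2Matrix a i j = ℕtoℚ (diam2Distance a i j)

C4-or-nonsingular : ∀ a b c d e f → C4Edges a b c d e f ⊎ Nonsingular (diam2Matrix (edges4 a b c d e f))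
C4-or-nonsingular = toWitness
  {a? = ∀-Bool? λ a → ∀-Bool? λ b → ∀-Bool? λ c → ∀-Bool? λ d → ∀-Bool? λ e → ∀-Bool? λ f →
        C4Edges? a b c d e f ⊎-dec nonsingular? (diam2Matrix (edges4 a b c d e f))} _

induced : ∀ {n m} → Graph n → (Fin m → Fin n) → Graph m
induced G f = record
  { adj   = λ x y → adj G (f x) (f y)
  ; sym   = λ x y → Graph.sym G (f x) (f y)
  ; irref = λ x → irref G (f x) }

-- No graph on five vertices has a 4-cycle on each of its 4-vertex subsets: each edge lies in three
-- of the five subsets, so it would have 5 · 4 / 3 edges. Four of the subsets already conflict.
no-five-C4s : ∀ {e01 e02 e03 e04 e12 e13 e14 e23 e24 e34} →
              C4Edges e01 e02 e03 e12 e13 e23 → C4Edges e01 e02 e04 e12 e14 e24 →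
              C4Edges e01 e03 e04 e13 e14 e34 → C4Edges e02 e03 e04 e23 e24 e34 → ⊥
no-five-C4s cycle-0123 cycle-0123 () _
no-five-C4s cycle-0213 cycle-0213 cycle-0213 ()
no-five-C4s cycle-0132 cycle-0132 () _

NoFourIndependentRows : ∀ {n m} → (Fin n → Fin m → ℚ) → Set
NoFourIndependentRows {n} M = ∀ (f : Fin 4 → Fin n) → ¬ RowsIndependent M f

module RankAtMost3 {n : ℕ} {G : Graph n} {D : Fin n → Fin n → ℕ} (isD : IsDistMatrix G D)
                   (no-four : NoFourIndependentRows (λ u v → ℕtoℚ (D u v))) where
  open Distances isD

  singular-submatrix : (f : Fin 4 → Fin n) {A : Matrix 4} →
                       (∀ i j → ℕtoℚ (D (f i) (f j)) ≡ A i j) → ¬ Nonsingular A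
  singular-submatrix f D≡A nonsingular =
    no-four f (nonsingular-submatrix⇒rows-independent (λ u v → ℕtoℚ (D u v)) f f D≡A nonsingular)

  diameter≤2 : ∀ u v → D u v ≤ 2
  diameter≤2 u v = ≮⇒≥ λ 2<d →
    let (f , D≡path) = path-submatrix 3 2<d
    in singular-submatrix f (λ i j → cong ℕtoℚ (D≡path i j)) P4-nonsingular

  induced-C4 : (f : Fin 4 → Fin n) → Injective _≡_ _≡_ f →
               C4Edges (adj G (f 0F) (f 1F)) (adj G (f 0F) (f 2F)) (adj G (f 0F) (f 3F))
                       (adj G (f 1F) (f 2F)) (adj G (f 1F) (f 3F)) (adj G (f 2F) (f 3F))
  induced-C4 f f-injective = fromInj₁ (⊥-elim ∘ singular-submatrix f D≡table)
    (C4-or-nonsingular (adj H 0F 1F) (adj H 0F 2F) (adj H 0F 3F) (adj H 1F 2F) (adj H 1F 3F) (adj H 2F 3F))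
    where
    H : Graph 4
    H = induced G f
    table : Fin 4 → Fin 4 → Bool
    table = edges4 (adj H 0F 1F) (adj H 0F 2F) (adj H 0F 3F) (adj H 1F 2F) (adj H 1F 3F) (adj H 2F 3F)
    D≡table : ∀ i j → ℕtoℚ (D (f i) (f j)) ≡ diam2Matrix table i j
    D≡table i j = cong ℕtoℚ (begin
      D (f i) (f j)                      ≡⟨ D≡diam2Distance diameter≤2 (f i) (f j) ⟩
      diam2Distance (adj G) (f i) (f j)  ≡⟨ diam2Distance-injective (adj G) f-injective i j ⟩
      diam2Distance (adj H) i j          ≡⟨ diam2Distance-cong {a = adj H} {b = table} i j (adj≡edges4 H i j) ⟩
      diam2Distance table i j            ∎)
      where open ≡-Reasoning

  no-five-vertices : (f : Fin 5 → Fin n) → Injective _≡_ _≡_ f → ⊥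
  no-five-vertices f f-injective =
    no-five-C4s (induced-C4 (f ∘ punchIn 4F) (skip 4F)) (induced-C4 (f ∘ punchIn 3F) (skip 3F))
                (induced-C4 (f ∘ punchIn 2F) (skip 2F)) (induced-C4 (f ∘ punchIn 1F) (skip 1F))
    where
    skip : ∀ k → Injective _≡_ _≡_ (f ∘ punchIn k)
    skip k = punchIn-injective k _ _ ∘ f-injective

  order≤4 : n ≤ 4
  order≤4 = ≮⇒≥ λ 4<n → no-five-vertices (λ i → inject≤ i 4<n) (inject≤-injective _ _ _ _)

-- Graphs of order three and four

relabels? : ∀ {m} (σ : Permutation′ m) (a b : Fin m → Fin m → Bool) →
            Dec (∀ u v → a (σ ⟨$⟩ʳ u) (σ ⟨$⟩ʳ v) ≡ b u v)
relabels? σ a b = all? λ u → all? λ v → a (σ ⟨$⟩ʳ u) (σ ⟨$⟩ʳ v) ≟ᵇ b u v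

iso-by-table : ∀ {m} (G H : Graph m) {a : Fin m → Fin m → Bool} (σ : Permutation′ m) →
               (∀ u v → adj G u v ≡ a u v) → True (relabels? σ (adj H) a) → Iso G H
iso-by-table G H σ G≡a H∘σ≡a = σ , λ u v → trans (toWitness H∘σ≡a u v) (sym (G≡a u v))

edges3 : Bool → Bool → Bool → Fin 3 → Fin 3 → Bool
edges3 a b c 0F 0F = false
edges3 a b c 0F 1F = a
edges3 a b c 0F 2F = b
edges3 a b c 1F 0F = a
edges3 a b c 1F 1F = false
edges3 a b c 1F 2F = c
edges3 a b c 2F 0F = b
edges3 a b c 2F 1F = c
edges3 a b c 2F 2F = false

adj≡edges3 : (H : Graph 3) → ∀ u v → adj H u v ≡ edges3 (adj H 0F 1F) (adj H 0F 2F) (adj H 1F 2F) u v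
adj≡edges3 H 0F 0F = irref H 0F
adj≡edges3 H 0F 1F = refl
adj≡edges3 H 0F 2F = refl
adj≡edges3 H 1F 0F = Graph.sym H 1F 0F
adj≡edges3 H 1F 1F = irref H 1F
adj≡edges3 H 1F 2F = refl
adj≡edges3 H 2F 0F = Graph.sym H 2F 0F
adj≡edges3 H 2F 1F = Graph.sym H 2F 1F
adj≡edges3 H 2F 2F = irref H 2F

connected-order3 : ∀ (G : Graph 3) {a b c} → (∀ u v → adj G u v ≡ edges3 a b c u v) → Connected G →
                   Iso G K3 ⊎ Iso G P3
connected-order3 G {true}  {true}  {true}  G≡e _ = inj₁ (iso-by-table G K3 id G≡e _)
connected-order3 G {true}  {false} {true}  G≡e _ = inj₂ (iso-by-table G P3 id G≡e _)
connected-order3 G {true}  {true}  {false} G≡e _ = inj₂ (iso-by-table G P3 (transpose 0F 1F) G≡e _)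
connected-order3 G {false} {true}  {true}  G≡e _ = inj₂ (iso-by-table G P3 (transpose 1F 2F) G≡e _)
connected-order3 G {false} {false} {_}     G≡e connected = contradiction connected
  (isolated⇒disconnected G {v = 1F} (λ { 0F → G≡e 0F 0F ; 1F → G≡e 0F 1F ; 2F → G≡e 0F 2F }) λ ())
connected-order3 G {false} {true}  {false} G≡e connected = contradiction connected
  (isolated⇒disconnected G {v = 0F} (λ { 0F → G≡e 1F 0F ; 1F → G≡e 1F 1F ; 2F → G≡e 1F 2F }) λ ())
connected-order3 G {true}  {false} {false} G≡e connected = contradiction connected
  (isolated⇒disconnected G {v = 0F} (λ { 0F → G≡e 2F 0F ; 1F → G≡e 2F 1F ; 2F → G≡e 2F 2F }) λ ())

C4Edges⇒Iso : ∀ (G : Graph 4) {a b c d e f} → (∀ u v → adj G u v ≡ edges4 a b c d e f u v) →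
              C4Edges a b c d e f → Iso G C4
C4Edges⇒Iso G G≡e cycle-0123 = iso-by-table G C4 id G≡e _
C4Edges⇒Iso G G≡e cycle-0213 = iso-by-table G C4 (transpose 1F 2F) G≡e _
C4Edges⇒Iso G G≡e cycle-0132 = iso-by-table G C4 (transpose 2F 3F) G≡e _

open RankAtMost3 using (order≤4; induced-C4)

three-or-four : ∀ {n} → 3 ≤ n → n ≤ 4 → n ≡ 3 ⊎ n ≡ 4
three-or-four {0} ()               _
three-or-four {1} (s≤s ())         _
three-or-four {2} (s≤s (s≤s ()))   _
three-or-four {3} _                _ = inj₁ refl
three-or-four {4} _                _ = inj₂ refl
three-or-four {suc (suc (suc (suc (suc _))))} _ (s≤s (s≤s (s≤s (s≤s ()))))

order-3-or-4 : ∀ {n} {G : Graph n} {D : Fin n → Fin n → ℕ} → Connected G → IsDistMatrix G D →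
               NoFourIndependentRows (λ u v → ℕtoℚ (D u v)) → n ≡ 3 ⊎ n ≡ 4 →
               Iso G K3 ⊎ Iso G P3 ⊎ Iso G C4
order-3-or-4 {G = G} connected _   _       (inj₁ refl) = map₂ inj₁ (connected-order3 G (adj≡edges3 G) connected)
order-3-or-4 {G = G} _         isD no-four (inj₂ refl) =
  inj₂ (inj₂ (C4Edges⇒Iso G (adj≡edges4 G) (induced-C4 isD no-four (λ i → i) (λ i≡j → i≡j))))

theorem6 : ∀ (n : ℕ) (G : Graph n) → Connected G → HasDistanceRank G 3 →
    Iso G K3 ⊎ Iso G P3 ⊎ Iso G C4
theorem6 n G connected (D , isD , (rows , independent) , no-four) =
  order-3-or-4 connected isD no-four
    (three-or-four (rows-independent⇒≤ (λ u v → ℕtoℚ (D u v)) rows independent) (order≤4 isD no-four))
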